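{- Let $H$ be a digraph (possibly with loops), let $D$ be an $H$-colored digraph, and let $\mathscr{F}$ be an $H$-class partition of $A(D)$ such that for every $F\in\mathscr{F}$, the arc-induced subdigraph $D\langle F\rangle$ is strongly connected and contains a vertex that is obstruction-free in $D$. Then for every $k\geq 2$, $D$ has a $(k,H)$-kernel by walks.
   Context: $H$ is a digraph possibly with loops; an $H$-colored digraph is a finite digraph $D$ without loops together with a coloring $\rho:A(D)\to V(H)$. For $x\in V(D)$, $A^-(x)$ and $A^+(x)$ denote the sets of arcs of $D$ entering and leaving $x$. A vertex $x$ is obstruction-free in $D$ if $(\rho(a),\rho(b))\in A(H)$ for all $a\in A^-(x)$, $b\in A^+(x)$. For $F\subseteq A(D)$, $D\langle F\rangle$ is the digraph with arc set $F$ and vertex set the vertices of $D$ incident with at least one arc of $F$. An $H$-class partition of $A(D)$ is a partition $\mathscr{F}$ of $A(D)$ such that for every pair of arcs $(u,v),(v,w)$ of $D$, $(\rho(u,v),\rho(v,w))\in A(H)$ if and only if there is $F\in\mathscr{F}$ with $\{(u,v),(v,w)\}\subseteq F$. For a walk $W=(x_0,\ldots,x_n)$ in $D$ there is an obstruction on $x_i$ if $(\rho(x_{i-1},x_i),\rho(x_i,x_{i+1}))\notin A(H)$; for an open walk, $O_H(W)$ is the set of $i\in\{1,\ldots,n-1\}$ with an obstruction on $x_i$, and the $H$-length is $l_H(W)=|O_H(W)|+1$ (for a closed walk indices are taken mod $n$, $i$ ranges over $\{0,\ldots,n-1\}$, and $l_H(W)=|O_H(W)|$). For $k\ge 2$,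 $l\ge 1$, a set $S\subseteq V(D)$ is a $(k,l,H)$-kernel by walks if every walk in $D$ between two different vertices of $S$ has $H$-length at least $k$, and for every $x\in V(D)\setminus S$ there is a walk from $x$ to some vertex of $S$ with $H$-length at most $l$. A $(k,H)$-kernel by walks is a $(k,k-1,H)$-kernel by walks. -}

module Defs where

open import Data.Nat using (ℕ; zero; suc; _+_; _≤_; _∸_)
open import Data.Fin using (Fin)
open import Data.Fin.Subset using (Subset; _∈_; _∉_)
open import Data.Bool using (Bool; true; false; if_then_else_)
open import Data.Product using (Σ; ∃; _×_; _,_)
open import Data.Sum using (_⊎_)
open import Relation.Binary.PropositionalEquality using (_≡_; _≢_)
open import Relation.Nullary using (¬_)
open import Function.Bundles using (_⇔_)

record Digraph (m : ℕ) : Set where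
  field
    hArc : Fin m → Fin m → Bool

-- An H-colored digraph: a finite digraph D on Fin n without loops (and
-- without parallel arcs), with a coloring ρ of its arcs by vertices of H.
-- ρ u v is only meaningful when (u,v) is an arc.
record HColored (m n : ℕ) : Set where
  field
    arc      : Fin n → Fin n → Bool
    loopless : ∀ x → arc x x ≡ false
    ρ        : Fin n → Fin n → Fin m

module _ {m n : ℕ} (H : Digraph m) (D : HColored m n) where
  open Digraph H
  open HColored D

  Arc : Fin n → Fin n → Set
  Arc u v = arc u v ≡ true

  HArc : Fin m → Fin m → Set
  HArc a b = hArc a b ≡ true

  data WalkIn (E : Fin n → Fin n → Set) : Fin n → Fin n → Set where
    []  : ∀ {x} → WalkIn E x x
    _∷_ : ∀ {x y z} → E x y → WalkIn E y z → WalkIn E x z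

  Walk : Fin n → Fin n → Set
  Walk = WalkIn Arc

  obstructions : ∀ {x y} → Walk x y → ℕ
  obstructions [] = 0
  obstructions (e ∷ []) = 0
  obstructions (_∷_ {x} {y} e (_∷_ {y} {z} e' ws)) =
    (if hArc (ρ x y) (ρ y z) then 0 else 1) + obstructions (e' ∷ ws)

  Hlength : ∀ {x y} → Walk x y → ℕ
  Hlength w = obstructions w + 1

  ObstructionFree : Fin n → Set
  ObstructionFree x = ∀ a b → Arc a x → Arc x b → HArc (ρ a x) (ρ x b)

  -- An H-class partition of A(D), given as a labelling cls of the arcs by
  -- class indices Fin p; the class F_c is {(u,v) ∈ A(D) | cls u v ≡ c}.
  IsHClassPartition : {p : ℕ} → (Fin n → Fin n → Fin p) → Set
  IsHClassPartition cls =
    ∀ u v w → Arc u v → Arc v w → HArc (ρ u v) (ρ v w) ⇔ (cls u v ≡ cls v w)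

  InClass : {p : ℕ} → (Fin n → Fin n → Fin p) → Fin p → Fin n → Fin n → Set
  InClass cls c u v = Arc u v × cls u v ≡ c

  VertexOfClass : {p : ℕ} → (Fin n → Fin n → Fin p) → Fin p → Fin n → Set
  VertexOfClass cls c x = ∃ λ y → InClass cls c x y ⊎ InClass cls c y x

  ClassStronglyConnected : {p : ℕ} → (Fin n → Fin n → Fin p) → Fin p → Set
  ClassStronglyConnected cls c =
    ∀ x y → VertexOfClass cls c x → VertexOfClass cls c y → WalkIn (InClass cls c) x y

  ClassHasObstructionFree : {p : ℕ} → (Fin n → Fin n → Fin p) → Fin p → Set
  ClassHasObstructionFree cls c = ∃ λ x → VertexOfClass cls c x × ObstructionFree x

  IsKLHKernel : ℕ → ℕ → Subset n → Set
  IsKLHKernel k l S =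
    (∀ x y → x ∈ S → y ∈ S → x ≢ y → (W : Walk x y) → k ≤ Hlength W)
    × (∀ x → x ∉ S → ∃ λ y → y ∈ S × Σ (Walk x y) λ W → Hlength W ≤ l)

  IsKHKernel : ℕ → Subset n → Set
  IsKHKernel k S = IsKLHKernel k (k ∸ 1) S

{-# OPTIONS --safe #-}
-- Call two vertices near if they are equal or both lie in some D⟨F⟩.
-- Inside a class consecutive arcs never form an obstruction (H-class
-- partition), and D⟨F⟩ is strongly connected, so near vertices are joined
-- by an obstruction-free walk; conversely a walk with j obstructions is
-- cut at its obstructions into j + 1 pieces each running inside one class.
-- Hence "joined by a walk of H-length ≤ k - 1" is the (k - 1)-fold power of
-- the symmetric relation "near", so it is symmetric, and any maximal
-- independent set of this relation is a (k,H)-kernel by walks.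
module Submission where

open import Defs
open import Data.Nat using (ℕ; zero; suc; _+_; _≤_; z≤n; s≤s)
open import Data.Nat.Properties
  using (≤-refl; ≤-reflexive; +-comm; +-assoc; +-monoʳ-≤; n≤1+n; _≤?_; ≰⇒>; module ≤-Reasoning)
open import Data.Fin using (Fin) renaming (_≟_ to _≟ᶠ_)
open import Data.Fin.Subset using (Subset; _∈_; _∉_; _∪_; ⁅_⁆; ⊥)
open import Data.Fin.Subset.Properties using (_∈?_; ∉⊥; x∈⁅x⁆; x∈⁅y⁆⇒x≡y; p⊆p∪q; q⊆p∪q; x∈p∪q⁻)
open import Data.Fin.Properties using (any?)
open import Data.Bool using (true; false; if_then_else_) renaming (_≟_ to _≟ᵇ_)
open import Data.List using (List; []; _∷_; allFin)
open import Data.List.Relation.Unary.Any using (here; there)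
open import Data.List.Membership.Propositional using () renaming (_∈_ to _∈ˡ_)
open import Data.List.Membership.Propositional.Properties using (∈-allFin)
open import Data.Product using (Σ; ∃; _×_; _,_; proj₁; proj₂)
open import Data.Sum using (_⊎_; inj₁; inj₂)
open import Data.Empty using (⊥-elim)
open import Relation.Nullary using (¬_; Dec; yes; no)
open import Relation.Nullary.Decidable using (_×-dec_; _⊎-dec_)
open import Level using (0ℓ)
open import Relation.Binary.Core using (Rel)
open import Relation.Binary.Definitions using (Symmetric; Decidable)
open import Relation.Binary.PropositionalEquality using (_≡_; _≢_; refl; sym; trans; cong; subst)
open import Function.Bundles using (Equivalence)

module MaximalIndependentSet {n : ℕ} (Q : Rel (Fin n) 0ℓ) where

  Independent : Subset n → Set
  Independent S = ∀ {s t} → s ∈ S → t ∈ S → s ≢ t → ¬ Q s t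

  Dominated : Subset n → Fin n → Set
  Dominated S x = x ∈ S ⊎ ∃ λ s → s ∈ S × Q x s

  module _ (Q? : Decidable Q) (Q-sym : Symmetric Q) where

    greedy : (xs : List (Fin n)) →
             ∃ λ S → Independent S × (∀ {x} → x ∈ˡ xs → Dominated S x)
    greedy [] = ⊥ , (λ s∈⊥ _ _ _ → ∉⊥ s∈⊥) , λ ()
    greedy (x ∷ xs) with greedy xs
    ... | S , indep , dom with any? (λ s → (s ∈? S) ×-dec Q? x s)
    ...   | yes x-dominated = S , indep , λ { (here refl) → inj₂ x-dominated ; (there y∈xs) → dom y∈xs }
    ...   | no x-free = ⁅ x ⁆ ∪ S , indep′ , dom′
      where
        inS′ : ∀ {y} → y ∈ S → y ∈ ⁅ x ⁆ ∪ S
        inS′ = q⊆p∪q ⁅ x ⁆ S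

        indep′ : Independent (⁅ x ⁆ ∪ S)
        indep′ s∈S′ t∈S′ s≢t q with x∈p∪q⁻ ⁅ x ⁆ S s∈S′ | x∈p∪q⁻ ⁅ x ⁆ S t∈S′
        ... | inj₁ s≡x | inj₁ t≡x = s≢t (trans (x∈⁅y⁆⇒x≡y x s≡x) (sym (x∈⁅y⁆⇒x≡y x t≡x)))
        ... | inj₁ s≡x | inj₂ t∈S = x-free (_ , t∈S , subst (λ u → Q u _) (x∈⁅y⁆⇒x≡y x s≡x) q)
        ... | inj₂ s∈S | inj₁ t≡x = x-free (_ , s∈S , Q-sym (subst (Q _) (x∈⁅y⁆⇒x≡y x t≡x) q))
        ... | inj₂ s∈S | inj₂ t∈S = indep s∈S t∈S s≢t q

        dom′ : ∀ {y} → y ∈ˡ x ∷ xs → Dominated (⁅ x ⁆ ∪ S) y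
        dom′ (here refl) = inj₁ (p⊆p∪q S (x∈⁅x⁆ x))
        dom′ (there y∈xs) with dom y∈xs
        ... | inj₁ y∈S = inj₁ (inS′ y∈S)
        ... | inj₂ (s , s∈S , q) = inj₂ (s , inS′ s∈S , q)

    ∃-independent-dominating : ∃ λ S → Independent S × (∀ x → Dominated S x)
    ∃-independent-dominating with greedy (allFin n)
    ... | S , indep , dom = S , indep , λ x → dom (∈-allFin x)

module ClassWalks {m n p : ℕ} (H : Digraph m) (D : HColored m n)
  (cls : Fin n → Fin n → Fin p) (partition : IsHClassPartition H D cls)
  (connected : ∀ c → ClassStronglyConnected H D cls c) where
  open Digraph H
  open HColored D

  private
    Walkᴰ : Fin n → Fin n → Set
    Walkᴰ = Walk H D

    obs : ∀ {x y} → Walkᴰ x y → ℕ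
    obs = obstructions H D

    V : Fin p → Fin n → Set
    V = VertexOfClass H D cls

  Near : Rel (Fin n) 0ℓ
  Near x y = x ≡ y ⊎ ∃ λ c → V c x × V c y

  Linked : ℕ → Rel (Fin n) 0ℓ
  Linked zero    x y = x ≡ y
  Linked (suc j) x y = ∃ λ z → Near x z × Linked j z y

  near-sym : Symmetric Near
  near-sym (inj₁ x≡y) = inj₁ (sym x≡y)
  near-sym (inj₂ (c , vx , vy)) = inj₂ (c , vy , vx)

  linked-refl : ∀ j x → Linked j x x
  linked-refl zero    x = refl
  linked-refl (suc j) x = x , inj₁ refl , linked-refl j x

  linked-mono : ∀ {i j x y} → i ≤ j → Linked i x y → Linked j x y
  linked-mono {j = j} z≤n refl = linked-refl j _
  linked-mono (s≤s i≤j) (z , xz , zy) = z , xz , linked-mono i≤j zy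

  linked-snoc : ∀ j {x y z} → Linked j x y → Near y z → Linked (suc j) x z
  linked-snoc zero    refl yz = _ , yz , refl
  linked-snoc (suc j) (w , xw , wy) yz = w , xw , linked-snoc j wy yz

  linked-sym : ∀ j → Symmetric (Linked j)
  linked-sym zero    = sym
  linked-sym (suc j) (z , xz , zy) = linked-snoc j (linked-sym j zy) (near-sym xz)

  near? : Decidable Near
  near? x y = (x ≟ᶠ y) ⊎-dec any? (λ c → vertexOfClass? c x ×-dec vertexOfClass? c y)
    where
      arc? : Decidable (Arc H D)
      arc? u v = arc u v ≟ᵇ true

      vertexOfClass? : ∀ c → (x : Fin n) → Dec (V c x)
      vertexOfClass? c x = any? λ y → (arc? x y ×-dec (cls x y ≟ᶠ c)) ⊎-dec (arc? y x ×-dec (cls y x ≟ᶠ c))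

  linked? : ∀ j → Decidable (Linked j)
  linked? zero    x y = x ≟ᶠ y
  linked? (suc j) x y = any? λ z → near? x z ×-dec linked? j z y

  _++_ : ∀ {x y z} → Walkᴰ x y → Walkᴰ y z → Walkᴰ x z
  []       ++ w = w
  (e ∷ u) ++ w = e ∷ (u ++ w)

  obstructions-++ : ∀ {x y z} (u : Walkᴰ x y) (w : Walkᴰ y z) → obs (u ++ w) ≤ obs u + suc (obs w)
  obstructions-++ [] w = n≤1+n _
  obstructions-++ (e ∷ []) [] = z≤n
  obstructions-++ (_∷_ {x} {y} e []) (_∷_ {y = z} e′ w) with hArc (ρ x y) (ρ y z)
  ... | true  = n≤1+n _
  ... | false = ≤-refl
  obstructions-++ (_∷_ {x} {y} e u@(_∷_ {y = z} _ _)) w = begin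
      o + obs (u ++ w)           ≤⟨ +-monoʳ-≤ o (obstructions-++ u w) ⟩
      o + (obs u + suc (obs w))  ≡⟨ +-assoc o (obs u) _ ⟨
      o + obs u + suc (obs w)    ∎
    where
      open ≤-Reasoning
      o = if hArc (ρ x y) (ρ y z) then 0 else 1

  forget : ∀ {c x y} → WalkIn H D (InClass H D cls c) x y → Walkᴰ x y
  forget []      = []
  forget (a ∷ w) = proj₁ a ∷ forget w

  obstructions-forget : ∀ {c x y} (w : WalkIn H D (InClass H D cls c) x y) → obs (forget w) ≡ 0
  obstructions-forget [] = refl
  obstructions-forget (a ∷ []) = refl
  obstructions-forget (_∷_ {x} {y} (e , cls≡c) w@(_∷_ {y = z} (e′ , cls′≡c) _))
    = trans (cong (λ b → (if b then 0 else 1) + obs (forget w)) no-obstruction) (obstructions-forget w)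
    where no-obstruction = Equivalence.from (partition x y z e e′) (trans cls≡c (sym cls′≡c))

  near⇒walk : ∀ {x y} → Near x y → Σ (Walkᴰ x y) λ w → obs w ≡ 0
  near⇒walk (inj₁ refl) = [] , refl
  near⇒walk (inj₂ (c , vx , vy)) = forget w , obstructions-forget w
    where w = connected c _ _ vx vy

  linked⇒walk : ∀ j {x y} → Linked (suc j) x y → Σ (Walkᴰ x y) λ w → obs w ≤ j
  linked⇒walk zero (_ , xz , refl) with near⇒walk xz
  ... | w , obs≡0 = w , ≤-reflexive obs≡0
  linked⇒walk (suc j) (_ , xz , zy) with near⇒walk xz | linked⇒walk j zy
  ... | u , obs≡0 | w , obs≤j = u ++ w , (begin
      obs (u ++ w)         ≤⟨ obstructions-++ u w ⟩
      obs u + suc (obs w)  ≡⟨ cong (_+ suc (obs w)) obs≡0 ⟩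
      suc (obs w)          ≤⟨ s≤s obs≤j ⟩
      suc j                ∎)
    where open ≤-Reasoning

  source∈class : ∀ {x y} (e : Arc H D x y) → V (cls x y) x
  source∈class {y = y} e = y , inj₁ (e , refl)

  target∈class : ∀ {c x y} → InClass H D cls c x y → V c y
  target∈class {x = x} a = x , inj₂ a

  -- A new link is spent exactly at each obstruction, where the class changes.
  walk⇒linked-from : ∀ {c x z w y} → V c x → (e : Arc H D z w) → cls z w ≡ c →
                     (u : Walkᴰ w y) → Linked (suc (obs (e ∷ u))) x y
  walk⇒linked-from vx e cls≡c [] = _ , inj₂ (_ , vx , target∈class (e , cls≡c)) , refl
  walk⇒linked-from {x = x} {z} {w} vx e cls≡c (_∷_ {y = v} e′ u) with hArc (ρ z w) (ρ w v) in h
  ... | true  = walk⇒linked-from vx e′ (trans (sym (Equivalence.to (partition z w v e e′) h)) cls≡c) u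
  ... | false = w , inj₂ (_ , vx , target∈class (e , cls≡c)) , walk⇒linked-from (source∈class e′) e′ refl u

  walk⇒linked : ∀ j {x y} (w : Walkᴰ x y) → obs w ≤ j → Linked (suc j) x y
  walk⇒linked j [] _ = linked-refl (suc j) _
  walk⇒linked j (e ∷ u) obs≤j = linked-mono (s≤s obs≤j) (walk⇒linked-from (source∈class e) e refl u)

theorem9 : ∀ {m n : ℕ} (H : Digraph m) (D : HColored m n)
    (p : ℕ) (cls : Fin n → Fin n → Fin p) →
    IsHClassPartition H D cls →
    (∀ c → ClassStronglyConnected H D cls c × ClassHasObstructionFree H D cls c) →
    ∀ k → 2 ≤ k → ∃ λ (S : Subset n) → IsKHKernel H D k S
theorem9 H D p cls partition hyp (suc (suc j)) (s≤s (s≤s z≤n)) = S , far , absorbing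
  where
    open ClassWalks H D cls partition (λ c → proj₁ (hyp c))
    open MaximalIndependentSet (Linked (suc j))

    kernel = ∃-independent-dominating (linked? (suc j)) (linked-sym (suc j))
    S = proj₁ kernel
    independent = proj₁ (proj₂ kernel)
    dominated = proj₂ (proj₂ kernel)

    far : ∀ x y → x ∈ S → y ∈ S → x ≢ y → (w : Walk H D x y) → suc (suc j) ≤ Hlength H D w
    far x y x∈S y∈S x≢y w with obstructions H D w ≤? j
    ... | yes obs≤j = ⊥-elim (independent x∈S y∈S x≢y (walk⇒linked j w obs≤j))
    ... | no obs≰j  = subst (suc (suc j) ≤_) (+-comm 1 _) (s≤s (≰⇒> obs≰j))

    absorbing : ∀ x → x ∉ S → ∃ λ y → y ∈ S × Σ (Walk H D x y) λ w → Hlength H D w ≤ suc j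
    absorbing x x∉S with dominated x
    ... | inj₁ x∈S = ⊥-elim (x∉S x∈S)
    ... | inj₂ (s , s∈S , linked) with linked⇒walk j linked
    ...   | w , obs≤j = s , s∈S , w , subst (_≤ suc j) (+-comm 1 _) (s≤s obs≤j)
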